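{- If $a,b,c\geq 1$ are integers, then $N_2(K_{a,b,c})\geq N_2(K_{a+b,c})-1$.
   Context: For a connected graph $G=(V,E)$, $N_2(G)$ is the minimum $N$ such that there is a map $g:V\to\{0,1,*\}^N$ with the property that for all $x,y\in V$, the graph distance between $x$ and $y$ equals the number of positions $j$ in which the $j$-th entries of $g(x)$ and $g(y)$ are distinct and neither equals $*$. $K_{a,b,c}$ denotes the complete tripartite graph with parts of sizes $a,b,c$, and $K_{m,n}$ the complete bipartite graph with parts of sizes $m,n$. -}

module Defs where

open import Data.Nat using (ℕ; zero; suc; _+_; _≤_)
open import Data.Fin using (Fin)
open import Data.Vec using (Vec; []; _∷_; lookup)
open import Data.Product using (Σ; _×_; _,_; proj₁)
open import Relation.Binary.PropositionalEquality using (_≡_; _≢_)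

record Graph : Set₁ where
  field
    V   : Set
    Adj : V → V → Set
open Graph public

data Walk (G : Graph) : V G → V G → ℕ → Set where
  here : ∀ {x} → Walk G x x zero
  step : ∀ {x y z k} → Adj G x y → Walk G y z k → Walk G x z (suc k)

Dist : (G : Graph) → V G → V G → ℕ → Set
Dist G x y d = Walk G x y d × (∀ k → Walk G x y k → d ≤ k)

completeMultipartite : ∀ {k} → Vec ℕ k → Graph
completeMultipartite {k} sizes = record
  { V   = Σ (Fin k) (λ i → Fin (lookup sizes i))
  ; Adj = λ u v → proj₁ u ≢ proj₁ v }

K₂ : ℕ → ℕ → Graph
K₂ m n = completeMultipartite (m ∷ n ∷ [])

K₃ : ℕ → ℕ → ℕ → Graph
K₃ a b c = completeMultipartite (a ∷ b ∷ c ∷ [])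

data Sym : Set where
  s0 s1 star : Sym

δ : Sym → Sym → ℕ
δ s0 s1 = 1
δ s1 s0 = 1
δ _  _  = 0

dist* : ∀ {N} → Vec Sym N → Vec Sym N → ℕ
dist* []       []       = 0
dist* (u ∷ us) (v ∷ vs) = δ u v + dist* us vs

Encoding : Graph → ℕ → Set
Encoding G N = Σ (V G → Vec Sym N) (λ g → ∀ x y → Dist G x y (dist* (g x) (g y)))

IsN₂ : Graph → ℕ → Set
IsN₂ G n = Encoding G n × (∀ m → Encoding G m → n ≤ m)

-- Given an encoding of K_{a,b,c}, merge its parts A and B into the first part
-- of K_{a+b,c} and prepend one coordinate that is 0 on A, 1 on B and * on C.
-- Vertices of A and B are at distance 1 in K_{a,b,c} but at distance 2 in
-- K_{a+b,c}, and the new coordinate supplies exactly the missing 1; every other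
-- distance is the same in both graphs and the new coordinate contributes 0.
module Submission where

open import Defs
open import Data.Nat using (ℕ; zero; suc; _+_; _≤_; z≤n; s≤s)
open import Data.Nat.Properties using (≤-antisym; +-comm)
open import Data.Fin using (Fin; zero; suc; _↑ˡ_; _↑ʳ_; splitAt; join; fromℕ<)
open import Data.Fin.Properties using (splitAt-↑ˡ; splitAt-↑ʳ; join-splitAt; ↑ˡ-injective; ↑ʳ-injective)
  renaming (_≟_ to _≟ᶠ_)
open import Data.Vec using (Vec; []; _∷_; lookup)
open import Data.Product using (_,_; proj₁)
open import Data.Sum using (_⊎_; inj₁; inj₂)
open import Data.Empty using (⊥-elim)
open import Relation.Nullary using (¬_; yes; no)
open import Relation.Binary.PropositionalEquality
  using (_≡_; _≢_; refl; sym; trans; cong; subst; ≢-sym)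

module _ {G : Graph} where

  Dist-unique : ∀ {x y d d′} → Dist G x y d → Dist G x y d′ → d ≡ d′
  Dist-unique (w , w-min) (w′ , w′-min) = ≤-antisym (w-min _ w′) (w′-min _ w)

  Dist-refl : ∀ {x} → Dist G x x 0
  Dist-refl = here , λ _ _ → z≤n

  Dist-adjacent : ∀ {x y} → Adj G x y → x ≢ y → Dist G x y 1
  Dist-adjacent {x} {y} xy x≢y = step xy here , shortest
    where
    shortest : ∀ k → Walk G x y k → 1 ≤ k
    shortest zero    here = ⊥-elim (x≢y refl)
    shortest (suc k) _    = s≤s z≤n

  Dist-common-neighbour : ∀ {x y z} → Adj G x z → Adj G z y → ¬ Adj G x y →
                          x ≢ y → Dist G x y 2
  Dist-common-neighbour {x} {y} xz zy ¬xy x≢y = step xz (step zy here) , shortest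
    where
    shortest : ∀ k → Walk G x y k → 2 ≤ k
    shortest zero          here           = ⊥-elim (x≢y refl)
    shortest (suc zero)    (step xy here) = ⊥-elim (¬xy xy)
    shortest (suc (suc k)) _              = s≤s (s≤s z≤n)

Dist-shift : ∀ {G H : Graph} {x y x′ y′} s {d d′} →
             Dist G x y d → Dist H x′ y′ (s + d) → Dist G x y d′ → Dist H x′ y′ (s + d′)
Dist-shift s D E D′ = subst (λ t → Dist _ _ _ (s + t)) (Dist-unique D D′) E

module CompleteMultipartite {k} (sizes : Vec ℕ k) where
  private G = completeMultipartite sizes

  Dist-otherPart : ∀ {x y : V G} → proj₁ x ≢ proj₁ y → Dist G x y 1
  Dist-otherPart x≁y = Dist-adjacent x≁y (λ x≡y → x≁y (cong proj₁ x≡y))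

  Dist-samePart : ∀ {i} {u v : Fin (lookup sizes i)} (z : V G) → proj₁ z ≢ i →
                  u ≢ v → Dist G (i , u) (i , v) 2
  Dist-samePart z z∉i u≢v =
    Dist-common-neighbour {z = z} (≢-sym z∉i) z∉i (λ i≢i → i≢i refl) λ { refl → u≢v refl }

↑ˡ≢↑ʳ : ∀ {m n} (i : Fin m) (j : Fin n) → i ↑ˡ n ≢ m ↑ʳ j
↑ˡ≢↑ʳ {m} {n} i j eq
  with trans (sym (splitAt-↑ˡ m i n)) (trans (cong (splitAt m) eq) (splitAt-↑ʳ m n j))
... | ()

module Merge {a b c : ℕ} (a₀ : Fin a) (c₀ : Fin c) where
  private
    module In₃ = CompleteMultipartite (a ∷ b ∷ c ∷ [])
    module In₂ = CompleteMultipartite (a + b ∷ c ∷ [])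

  data Cell : V (K₂ (a + b) c) → Set where
    inA : (p : Fin a) → Cell (zero , p ↑ˡ b)
    inB : (q : Fin b) → Cell (zero , a ↑ʳ q)
    inC : (r : Fin c) → Cell (suc zero , r)

  cell : ∀ v → Cell v
  cell (zero , i)     = subst (λ j → Cell (zero , j)) (join-splitAt a b i) (joinCell (splitAt a i))
    where
    joinCell : (s : Fin a ⊎ Fin b) → Cell (zero , join a b s)
    joinCell (inj₁ p) = inA p
    joinCell (inj₂ q) = inB q
  cell (suc zero , r) = inC r

  unmerged : ∀ {v} → Cell v → V (K₃ a b c)
  unmerged (inA p) = zero , p
  unmerged (inB q) = suc zero , q
  unmerged (inC r) = suc (suc zero) , r

  sideBit : ∀ {v} → Cell v → Sym
  sideBit (inA _) = s0
  sideBit (inB _) = s1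
  sideBit (inC _) = star

  Dist-merge : ∀ {x y} (cx : Cell x) (cy : Cell y) {d} →
               Dist (K₃ a b c) (unmerged cx) (unmerged cy) d →
               Dist (K₂ (a + b) c) x y (δ (sideBit cx) (sideBit cy) + d)
  Dist-merge (inA p) (inA q) with p ≟ᶠ q
  ... | yes refl = Dist-shift 0 Dist-refl Dist-refl
  ... | no p≢q   = Dist-shift 0 (In₃.Dist-samePart (suc (suc zero) , c₀) (λ ()) p≢q)
                                (In₂.Dist-samePart (suc zero , c₀) (λ ()) (λ e → p≢q (↑ˡ-injective b p q e)))
  Dist-merge (inB p) (inB q) with p ≟ᶠ q
  ... | yes refl = Dist-shift 0 Dist-refl Dist-refl
  ... | no p≢q   = Dist-shift 0 (In₃.Dist-samePart (suc (suc zero) , c₀) (λ ()) p≢q)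
                                (In₂.Dist-samePart (suc zero , c₀) (λ ()) (λ e → p≢q (↑ʳ-injective a p q e)))
  Dist-merge (inC r) (inC s) with r ≟ᶠ s
  ... | yes refl = Dist-shift 0 Dist-refl Dist-refl
  ... | no r≢s   = Dist-shift 0 (In₃.Dist-samePart (zero , a₀) (λ ()) r≢s)
                                (In₂.Dist-samePart (zero , a₀ ↑ˡ b) (λ ()) r≢s)
  Dist-merge (inA p) (inB q) =
    Dist-shift 1 (In₃.Dist-otherPart (λ ())) (In₂.Dist-samePart (suc zero , c₀) (λ ()) (↑ˡ≢↑ʳ p q))
  Dist-merge (inB p) (inA q) =
    Dist-shift 1 (In₃.Dist-otherPart (λ ())) (In₂.Dist-samePart (suc zero , c₀) (λ ()) (≢-sym (↑ˡ≢↑ʳ q p)))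
  Dist-merge (inA _) (inC _) = Dist-shift 0 (In₃.Dist-otherPart (λ ())) (In₂.Dist-otherPart (λ ()))
  Dist-merge (inB _) (inC _) = Dist-shift 0 (In₃.Dist-otherPart (λ ())) (In₂.Dist-otherPart (λ ()))
  Dist-merge (inC _) (inA _) = Dist-shift 0 (In₃.Dist-otherPart (λ ())) (In₂.Dist-otherPart (λ ()))
  Dist-merge (inC _) (inB _) = Dist-shift 0 (In₃.Dist-otherPart (λ ())) (In₂.Dist-otherPart (λ ()))

  mergeEncoding : ∀ {N} → Encoding (K₃ a b c) N → Encoding (K₂ (a + b) c) (suc N)
  mergeEncoding {N} (g , g-dist) = merged , λ x y → Dist-merge (cell x) (cell y) (g-dist _ _)
    where
    merged : V (K₂ (a + b) c) → Vec Sym (suc N)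
    merged v = sideBit (cell v) ∷ g (unmerged (cell v))

mainTheorem12 : ∀ (a b c : ℕ) → 1 ≤ a → 1 ≤ b → 1 ≤ c →
    ∀ (n m : ℕ) → IsN₂ (K₃ a b c) n → IsN₂ (K₂ (a + b) c) m → m ≤ n + 1
mainTheorem12 a b c 1≤a _ 1≤c n m (encoding , _) (_ , minimal) =
  subst (m ≤_) (+-comm 1 n) (minimal (suc n) (Merge.mergeEncoding (fromℕ< 1≤a) (fromℕ< 1≤c) encoding))
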